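{- Let $p$ be a prime, $m$ a positive integer, and $D\subset\mathbb Z_p$ a coset of $p^m\mathbb Z_p$. Let $C\subset D$ be a convex subset and let $f:C\to\mathbb Z_p$ be a surjective affine map (the restriction to $C$ of a map $x\mapsto ax+c$ with $a,c\in\mathbb Q_p$). Then for every $\beta\in\mathbb Z_p$ there is a convex subset $B\subset C$ such that the function $g:B\to\mathbb Q_p$, $g(x)=\frac{f(x)}{p^m}+\frac{x-\beta}{p^m}$, maps $B$ surjectively onto $\mathbb Z_p$.
   Context: $\mathbb Q_p$ denotes the $p$-adic numbers and $\mathbb Z_p$ the $p$-adic integers. A subset of $\mathbb Q_p$ is called convex if it is empty or a coset $L+u$ of a $\mathbb Z_p$-submodule $L$ of $\mathbb Q_p$. -}

module Defs where

open import Level using (0ℓ)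
open import Data.Nat as ℕ using (ℕ; _^_)
open import Data.Integer as ℤ using (ℤ; +_; _+_; _*_; -_; _-_)
open import Data.Integer.Divisibility.Signed
  using (_∣_; divides; ∣m∣n⇒∣m+n; ∣n⇒∣m*n; ∣m⇒∣m*n; ∣m⇒∣-m)
open import Data.Integer.Properties using (+-inverseʳ; *-zeroˡ; neg-distrib-+; *-distribʳ-+)
open import Data.Integer.Solver using (module +-*-Solver)
open import Data.Product using (Σ; _×_; _,_)
open import Data.Sum using (_⊎_)
open import Relation.Nullary using (¬_)
open import Relation.Unary using (Pred)
open import Relation.Binary.PropositionalEquality using (_≡_; refl; sym; subst; trans; cong)
open import Function using (_⇔_)

-- p-adic integers ℤₚ: coherent sequences of integer approximations
-- x = (x₀, x₁, …) with x (n+1) ≡ x n (mod pⁿ).  The p-adic integer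
-- represented is lim x n; two sequences represent the same p-adic
-- integer iff x n ≡ y n (mod pⁿ) for all n (relation _≈ℤₚ_).

record ℤₚ (p : ℕ) : Set where
  constructor mkℤₚ
  field
    seq : ℕ → ℤ
    coh : ∀ n → (+ (p ^ n)) ∣ (seq (ℕ.suc n) - seq n)
open ℤₚ public

private
  ∣0 : ∀ k → k ∣ (+ 0)
  ∣0 k = divides (+ 0) (sym (*-zeroˡ k))

  ∣self-self : ∀ k c → k ∣ (c - c)
  ∣self-self k c = subst (k ∣_) (sym (+-inverseʳ c)) (∣0 k)

  open +-*-Solver

  mul-id : ∀ a b c d → a * b - c * d ≡ a * (b - d) + (a - c) * d
  mul-id = solve 4 (λ a b c d → a :* b :- c :* d := a :* (b :- d) :+ (a :- c) :* d) refl

  add-id : ∀ a b c d → (a + b) - (c + d) ≡ (a - c) + (b - d)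
  add-id = solve 4 (λ a b c d → (a :+ b) :- (c :+ d) := (a :- c) :+ (b :- d)) refl

  neg-id : ∀ a c → (- a) - (- c) ≡ - (a - c)
  neg-id = solve 2 (λ a c → (:- a) :- (:- c) := :- (a :- c)) refl

module _ {p : ℕ} where

  infix 4 _≈ℤₚ_
  _≈ℤₚ_ : ℤₚ p → ℤₚ p → Set
  x ≈ℤₚ y = ∀ n → (+ (p ^ n)) ∣ (seq x n - seq y n)

  constℤₚ : ℤ → ℤₚ p
  constℤₚ c = mkℤₚ (λ _ → c) (λ n → ∣self-self (+ (p ^ n)) c)

  infixl 6 _+ℤₚ_
  infixl 7 _*ℤₚ_
  _+ℤₚ_ : ℤₚ p → ℤₚ p → ℤₚ p
  x +ℤₚ y = mkℤₚ (λ n → seq x n + seq y n) λ n →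
    subst (_ ∣_) (sym (add-id (seq x (ℕ.suc n)) (seq y (ℕ.suc n)) (seq x n) (seq y n)))
          (∣m∣n⇒∣m+n (coh x n) (coh y n))

  _*ℤₚ_ : ℤₚ p → ℤₚ p → ℤₚ p
  x *ℤₚ y = mkℤₚ (λ n → seq x n * seq y n) λ n →
    subst (_ ∣_) (sym (mul-id (seq x (ℕ.suc n)) (seq y (ℕ.suc n)) (seq x n) (seq y n)))
          (∣m∣n⇒∣m+n (∣n⇒∣m*n (seq x (ℕ.suc n)) (coh y n)) (∣m⇒∣m*n (seq y n) (coh x n)))

  -ℤₚ_ : ℤₚ p → ℤₚ p
  -ℤₚ x = mkℤₚ (λ n → - seq x n) λ n →
    subst (_ ∣_) (sym (neg-id (seq x (ℕ.suc n)) (seq x n))) (∣m⇒∣-m (coh x n))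

record ℚₚ (p : ℕ) : Set where
  constructor _/p^_
  field
    num : ℤₚ p
    ex  : ℕ
open ℚₚ public

module _ {p : ℕ} where

  private
    P^ : ℕ → ℤₚ p
    P^ k = constℤₚ (+ (p ^ k))

  infix 4 _≈_
  _≈_ : ℚₚ p → ℚₚ p → Set
  (u /p^ k) ≈ (v /p^ l) = (P^ l *ℤₚ u) ≈ℤₚ (P^ k *ℤₚ v)

  infixl 6 _+ₚ_ _-ₚ_
  infixl 7 _*ₚ_
  _+ₚ_ : ℚₚ p → ℚₚ p → ℚₚ p
  (u /p^ k) +ₚ (v /p^ l) = (P^ l *ℤₚ u +ℤₚ P^ k *ℤₚ v) /p^ (k ℕ.+ l)

  _*ₚ_ : ℚₚ p → ℚₚ p → ℚₚ p
  (u /p^ k) *ₚ (v /p^ l) = (u *ℤₚ v) /p^ (k ℕ.+ l)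

  -ₚ_ : ℚₚ p → ℚₚ p
  -ₚ (u /p^ k) = (-ℤₚ u) /p^ k

  _-ₚ_ : ℚₚ p → ℚₚ p → ℚₚ p
  x -ₚ y = x +ₚ (-ₚ y)

  _/ₚp^_ : ℚₚ p → ℕ → ℚₚ p
  (u /p^ k) /ₚp^ m = u /p^ (k ℕ.+ m)

  ι : ℤₚ p → ℚₚ p
  ι z = z /p^ 0

  0ₚ : ℚₚ p
  0ₚ = ι (constℤₚ (+ 0))

  Inℤₚ : ℚₚ p → Set
  Inℤₚ x = Σ (ℤₚ p) λ z → x ≈ ι z

  record IsSubmodule (L : Pred (ℚₚ p) 0ℓ) : Set where
    field
      resp  : ∀ {x y} → x ≈ y → L x → L y
      zero∈ : L 0ₚ
      +-closed : ∀ {x y} → L x → L y → L (x +ₚ y)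
      scale-closed : ∀ (r : ℤₚ p) {x} → L x → L (ι r *ₚ x)

  Convex : Pred (ℚₚ p) 0ℓ → Set₁
  Convex S = (∀ x → ¬ S x)
           ⊎ Σ (Pred (ℚₚ p) 0ℓ) λ L → IsSubmodule L × Σ (ℚₚ p) λ u →
               ∀ x → S x ⇔ Σ (ℚₚ p) λ l → L l × x ≈ l +ₚ u

  Coset : ℤₚ p → ℕ → Pred (ℚₚ p) 0ℓ
  Coset d m x = Σ (ℤₚ p) λ z → x ≈ ι d +ₚ ι (constℤₚ (+ (p ^ m))) *ₚ ι z

  MapsOntoℤₚ : Pred (ℚₚ p) 0ℓ → (ℚₚ p → ℚₚ p) → Set
  MapsOntoℤₚ S h = (∀ x → S x → Inℤₚ (h x))
                 × (∀ (y : ℤₚ p) → Σ (ℚₚ p) λ x → S x × h x ≈ ι y)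

module Submission where

-- Choose x₀, x₁ ∈ C with f x₀ = β - d and f x₁ = f x₀ + 1, where f x = a x + c.
-- Both lie in d + pᵐℤₚ, say x_i = d + pᵐ z_i, so δ = x₁ - x₀ = pᵐ (z₁ - z₀) is
-- divisible by p and a δ = 1. Hence 1 + δ is a unit of ℤₚ with inverse ν, and
-- w = pᵐ ν δ ∈ ℤₚ δ satisfies (a + 1) w = pᵐ ν (a δ + δ) = pᵐ ν (1 + δ) = pᵐ.
-- The line B = x₀ + ℤₚ w lies in C = L + u because δ ∈ L, and at x = x₀ + t w
-- f x + x - β = t pᵐ + (β - d) + (d + pᵐ z₀) - β = pᵐ (t + z₀),
-- so g x = (f x + x - β) / pᵐ = t + z₀ and g maps B onto ℤₚ.

open import Defs hiding (_≈_)
open import Level using (0ℓ)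
open import Algebra.Bundles using (CommutativeRing)
import Algebra.Consequences.Setoid as Consequences
open import Algebra.Solver.Ring.AlmostCommutativeRing
  using (_-Raw-AlmostCommutative⟶_; fromCommutativeRing)
import Algebra.Solver.Ring as Solver
open import Data.Empty using (⊥-elim)
open import Data.Integer.Base using (ℤ; +_; +-*-rawRing)
open import Data.Integer.Properties using (_≟_; pos-*; *-zeroˡ; i≡j⇒i-j≡0) renaming (*-comm to ℤ*-comm)
open import Data.Integer.Divisibility.Signed
open import Data.List using (_∷_; [])
open import Data.Maybe using (Maybe; just; nothing)
open import Data.Nat as ℕ using (ℕ; zero; suc; _≤_)
open import Data.Nat.Properties using (^-distribˡ-+-*; m^n≢0)
open import Data.Nat.Primality using (Prime; prime)
open import Data.Product using (Σ; _×_; _,_; proj₁; proj₂)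
open import Data.Sum using (inj₁; inj₂)
open import Function using (_⇔_; mk⇔; Equivalence)
open import Relation.Binary.Bundles using (Setoid)
open import Relation.Binary.PropositionalEquality
  using (_≡_; refl; sym; trans; cong; subst; subst₂; module ≡-Reasoning)
open import Relation.Binary.Structures using (IsEquivalence)
open import Relation.Nullary using (yes; no)
open import Relation.Unary using (Pred; _⊆_)

-- The morphism from ℤ only supplies integer coefficients to the ring solver.
module RingIdentities {c ℓ} (R : CommutativeRing c ℓ)
  (ℤ⟶R : +-*-rawRing -Raw-AlmostCommutative⟶ fromCommutativeRing R) where

  open CommutativeRing R renaming (refl to ≈-refl; sym to ≈-sym; trans to ≈-trans)
  open import Relation.Binary.Reasoning.Setoid setoid
  open _-Raw-AlmostCommutative⟶_ ℤ⟶R using (⟦_⟧)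

  private
    coefficients≈? : ∀ i j → Maybe (⟦ i ⟧ ≈ ⟦ j ⟧)
    coefficients≈? i j with i ≟ j
    ... | yes refl = just ≈-refl
    ... | no _     = nothing

  open Solver +-*-rawRing (fromCommutativeRing R) ℤ⟶R coefficients≈?
    using (solve; _:+_; _:*_; _:-_; _:=_)

  [d+Pz]-[d+Pz′]≈P[z-z′] : ∀ {x y d P z z′} →
    x ≈ d + P * z → y ≈ d + P * z′ → x - y ≈ P * (z - z′)
  [d+Pz]-[d+Pz′]≈P[z-z′] {x} {y} {d} {P} {z} {z′} x≈ y≈ = begin
    x - y                       ≈⟨ +-cong x≈ (-‿cong y≈) ⟩
    (d + P * z) - (d + P * z′)  ≈⟨ solve 4 (λ d P z z′ → (d :+ P :* z) :- (d :+ P :* z′) := P :* (z :- z′))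
                                          ≈-refl d P z z′ ⟩
    P * (z - z′)                ∎

  a[x-y]≈1 : ∀ {a c x y b} →
    a * x + c ≈ b + 1# → a * y + c ≈ b → a * (x - y) ≈ 1#
  a[x-y]≈1 {a} {c} {x} {y} {b} ax+c≈b+1 ay+c≈b = begin
    a * (x - y)                ≈⟨ solve 4 (λ a c x y → a :* (x :- y) := (a :* x :+ c) :- (a :* y :+ c))
                                         ≈-refl a c x y ⟩
    (a * x + c) - (a * y + c)  ≈⟨ +-cong ax+c≈b+1 (-‿cong ay+c≈b) ⟩
    (b + 1#) - b               ≈⟨ solve 2 (λ b one → (b :+ one) :- b := one) ≈-refl b 1# ⟩
    1#                         ∎

  a*w+w≈P : ∀ {a δ ν P w} → w ≈ (P * ν) * δ → a * δ ≈ 1# → (1# + δ) * ν ≈ 1# → a * w + w ≈ P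
  a*w+w≈P {a} {δ} {ν} {P} {w} w≈ aδ≈1 [1+δ]ν≈1 = begin
    a * w + w                        ≈⟨ +-cong (*-congˡ w≈) w≈ ⟩
    a * ((P * ν) * δ) + (P * ν) * δ  ≈⟨ solve 4 (λ a δ ν P → a :* ((P :* ν) :* δ) :+ (P :* ν) :* δ
                                                          := P :* ((a :* δ :+ δ) :* ν)) ≈-refl a δ ν P ⟩
    P * ((a * δ + δ) * ν)            ≈⟨ *-congˡ (*-congʳ (+-congʳ aδ≈1)) ⟩
    P * ((1# + δ) * ν)               ≈⟨ *-congˡ [1+δ]ν≈1 ⟩
    P * 1#                           ≈⟨ *-identityʳ P ⟩
    P                                ∎

  [ax+c]+[x-b]≈P[t+z] : ∀ {a c b d P w x₀ z t x} →
    a * w + w ≈ P → a * x₀ + c ≈ b - d → x₀ ≈ d + P * z → x ≈ t * w + x₀ →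
    (a * x + c) + (x - b) ≈ P * (t + z)
  [ax+c]+[x-b]≈P[t+z] {a} {c} {b} {d} {P} {w} {x₀} {z} {t} {x} aw+w≈P ax₀+c≈b-d x₀≈ x≈ = begin
    (a * x + c) + (x - b)
      ≈⟨ +-cong (+-congʳ (*-congˡ x≈)) (+-congʳ x≈) ⟩
    (a * (t * w + x₀) + c) + ((t * w + x₀) - b)
      ≈⟨ solve 6 (λ a c b w x₀ t → (a :* (t :* w :+ x₀) :+ c) :+ ((t :* w :+ x₀) :- b)
                                  := t :* (a :* w :+ w) :+ ((a :* x₀ :+ c) :+ (x₀ :- b))) ≈-refl a c b w x₀ t ⟩
    t * (a * w + w) + ((a * x₀ + c) + (x₀ - b))
      ≈⟨ +-cong (*-congˡ aw+w≈P) (+-cong ax₀+c≈b-d (+-congʳ x₀≈)) ⟩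
    t * P + ((b - d) + ((d + P * z) - b))
      ≈⟨ solve 5 (λ b d P z t → t :* P :+ ((b :- d) :+ ((d :+ P :* z) :- b)) := P :* (t :+ z)) ≈-refl b d P z t ⟩
    P * (t + z)
      ∎

  [l+u]-[l′+u]≈l-l′ : ∀ {x y l l′ u} → x ≈ l + u → y ≈ l′ + u → x - y ≈ l - l′
  [l+u]-[l′+u]≈l-l′ {x} {y} {l} {l′} {u} x≈ y≈ = begin
    x - y               ≈⟨ +-cong x≈ (-‿cong y≈) ⟩
    (l + u) - (l′ + u)  ≈⟨ solve 3 (λ l l′ u → (l :+ u) :- (l′ :+ u) := l :- l′) ≈-refl l l′ u ⟩
    l - l′              ∎

module PAdic {p : ℕ} .{{p-nontrivial : ℕ.NonTrivial p}} where

  open Defs using (_≈_)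
  open import Data.Integer.Base using (_+_; _*_; -_; _-_; _^_)
  open import Data.Integer.Tactic.RingSolver using (solve-∀; solve)

  private instance
    p-nonZero : ℕ.NonZero p
    p-nonZero = ℕ.nonTrivial⇒nonZero p

  infix 8 p^_
  p^_ : ℕ → ℤ
  p^ k = + (p ℕ.^ k)

  p^-+ : ∀ k l → p^ (k ℕ.+ l) ≡ p^ k * p^ l
  p^-+ k l = trans (cong +_ (^-distribˡ-+-* p k l)) (pos-* (p ℕ.^ k) (p ℕ.^ l))

  i≡j⇒k∣i-j : ∀ {k i j} → i ≡ j → k ∣ i - j
  i≡j⇒k∣i-j {k} i≡j = subst (k ∣_) (sym (i≡j⇒i-j≡0 i≡j)) (divides (+ 0) (sym (*-zeroˡ k)))

  k∣i-i : ∀ {k} i → k ∣ i - i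
  k∣i-i i = i≡j⇒k∣i-j {i = i} refl

  seq-congruent : (x : ℤₚ p) → ∀ i n → p^ n ∣ seq x (i ℕ.+ n) - seq x n
  seq-congruent x zero    n = k∣i-i (seq x n)
  seq-congruent x (suc i) n =
    subst (p^ n ∣_) (telescope (seq x (suc i ℕ.+ n)) (seq x (i ℕ.+ n)) (seq x n))
      (∣m∣n⇒∣m+n (∣-trans (divides (p^ i) (p^-+ i n)) (coh x (i ℕ.+ n))) (seq-congruent x i n))
    where
    telescope : ∀ a b c → (a - b) + (b - c) ≡ a - c
    telescope = solve-∀

  -- x ≈ y computes by matching on x and y, so Agda cannot recover x and y from it;
  -- as the arguments of a record type they can be inferred from x ≋ y.
  infix 4 _≋_
  record _≋_ (x y : ℚₚ p) : Set where
    constructor ≈⇒≋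
    field ≋⇒≈ : x ≈ y
  open _≋_ public

  ≋-refl : ∀ {x} → x ≋ x
  ≋-refl {u /p^ k} = ≈⇒≋ λ n → k∣i-i (p^ k * seq u n)

  ≋-sym : ∀ {x y} → x ≋ y → y ≋ x
  ≋-sym {u /p^ k} {v /p^ l} (≈⇒≋ x≈y) = ≈⇒≋ λ n →
    subst (p^ n ∣_) (flip (p^ l * seq u n) (p^ k * seq v n)) (∣m⇒∣-m (x≈y n))
    where
    flip : ∀ a b → - (a - b) ≡ b - a
    flip = solve-∀

  -- At level l + n the hypotheses eliminate v and leave pˡ times the goal, modulo
  -- pˡ pⁿ; cancelling pˡ and descending to level n by coherence gives x ≈ z.
  ≋-trans : ∀ {x y z} → x ≋ y → y ≋ z → x ≋ z
  ≋-trans {u /p^ k} {v /p^ l} {w /p^ j} (≈⇒≋ x≈y) (≈⇒≋ y≈z) = ≈⇒≋ x≈z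
    where
    eliminate-v : ∀ J K L u v w → J * (L * u - K * v) + K * (J * v - L * w) ≡ L * (J * u - K * w)
    eliminate-v = solve-∀
    x≈z-at-level : ∀ n → p^ l * p^ n ∣ p^ l * (p^ j * seq u (l ℕ.+ n) - p^ k * seq w (l ℕ.+ n))
    x≈z-at-level n =
      subst₂ _∣_ (p^-+ l n) (eliminate-v (p^ j) (p^ k) (p^ l) (seq u N) (seq v N) (seq w N))
        (∣m∣n⇒∣m+n (∣n⇒∣m*n (p^ j) (x≈y N)) (∣n⇒∣m*n (p^ k) (y≈z N)))
      where N = l ℕ.+ n
    descend : ∀ J K u u′ w w′ → (J * u′ - K * w′) - J * (u′ - u) + K * (w′ - w) ≡ J * u - K * w
    descend = solve-∀
    x≈z : (u /p^ k) ≈ (w /p^ j)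
    x≈z n = subst (p^ n ∣_) (descend (p^ j) (p^ k) (seq u n) (seq u (l ℕ.+ n)) (seq w n) (seq w (l ℕ.+ n)))
      (∣m∣n⇒∣m+n (∣m∣n⇒∣m-n (*-cancelˡ-∣ (p^ l) {{m^n≢0 p l}} (x≈z-at-level n))
                              (∣n⇒∣m*n (p^ j) (seq-congruent u l n)))
                 (∣n⇒∣m*n (p^ k) (seq-congruent w l n)))

  1ₚ : ℚₚ p
  1ₚ = ι (constℤₚ (+ 1))

  1ℤₚ : ℤₚ p
  1ℤₚ = constℤₚ (+ 1)

  infixl 6 _-ℤₚ_
  _-ℤₚ_ : ℤₚ p → ℤₚ p → ℤₚ p
  s -ℤₚ t = s +ℤₚ (-ℤₚ t)

  [s-t]+t≈s : ∀ s t → (s -ℤₚ t) +ℤₚ t ≈ℤₚ s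
  [s-t]+t≈s s t n = i≡j⇒k∣i-j (cancel (seq s n) (seq t n))
    where
    cancel : ∀ a b → (a + - b) + b ≡ a
    cancel = solve-∀

  infix 8 p^ₚ_
  p^ₚ_ : ℕ → ℚₚ p
  p^ₚ m = ι (constℤₚ (p^ m))

  -- The ring operations are opaque copies of _+ₚ_, _*ₚ_ and -ₚ_. Those compute on
  -- the underlying integer sequences, so unifying with them (for instance, to infer
  -- an implicit argument) would unfold entire p-adic expansions.
  infixl 6 _⊕_
  infixl 7 _⊗_
  infix  8 ⊖_
  opaque
    _⊕_ : ℚₚ p → ℚₚ p → ℚₚ p
    _⊕_ = _+ₚ_

    _⊗_ : ℚₚ p → ℚₚ p → ℚₚ p
    _⊗_ = _*ₚ_

    ⊖_ : ℚₚ p → ℚₚ p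
    ⊖_ = -ₚ_

  -- At each level n, every law below comes down to an integer identity between
  -- cross-multiplied representatives; matching the equations pᵏ⁺ˡ ≡ pᵏ pˡ against
  -- refl turns it into a polynomial identity for the ring solver.
  opaque
    unfolding _⊕_ _⊗_ ⊖_

    ⊕-cong : ∀ {x x′ y y′} → x ≋ x′ → y ≋ y′ → x ⊕ y ≋ x′ ⊕ y′
    ⊕-cong {u /p^ k} {u′ /p^ k′} {v /p^ l} {v′ /p^ l′} (≈⇒≋ u≈u′) (≈⇒≋ v≈v′) = ≈⇒≋ λ n →
      subst (p^ n ∣_)
        (sym (cross-multiplied (p^ k) (p^ k′) (p^ l) (p^ l′) (seq u n) (seq u′ n) (seq v n) (seq v′ n)
                               (p^-+ k′ l′) (p^-+ k l)))
        (∣m∣n⇒∣m+n (∣n⇒∣m*n (p^ l * p^ l′) (u≈u′ n)) (∣n⇒∣m*n (p^ k * p^ k′) (v≈v′ n)))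
      where
      cross-multiplied : ∀ K K′ L L′ u u′ v v′ {K′L′ KL} → K′L′ ≡ K′ * L′ → KL ≡ K * L →
        K′L′ * (L * u + K * v) - KL * (L′ * u′ + K′ * v′)
          ≡ (L * L′) * (K′ * u - K * u′) + (K * K′) * (L′ * v - L * v′)
      cross-multiplied K K′ L L′ u u′ v v′ refl refl = solve (K ∷ K′ ∷ L ∷ L′ ∷ u ∷ u′ ∷ v ∷ v′ ∷ [])

    ⊗-cong : ∀ {x x′ y y′} → x ≋ x′ → y ≋ y′ → x ⊗ y ≋ x′ ⊗ y′
    ⊗-cong {u /p^ k} {u′ /p^ k′} {v /p^ l} {v′ /p^ l′} (≈⇒≋ u≈u′) (≈⇒≋ v≈v′) = ≈⇒≋ λ n →
      subst (p^ n ∣_)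
        (sym (cross-multiplied (p^ k) (p^ k′) (p^ l) (p^ l′) (seq u n) (seq u′ n) (seq v n) (seq v′ n)
                               (p^-+ k′ l′) (p^-+ k l)))
        (∣m∣n⇒∣m+n (∣n⇒∣m*n (p^ l′ * seq v n) (u≈u′ n)) (∣n⇒∣m*n (p^ k * seq u′ n) (v≈v′ n)))
      where
      cross-multiplied : ∀ K K′ L L′ u u′ v v′ {K′L′ KL} → K′L′ ≡ K′ * L′ → KL ≡ K * L →
        K′L′ * (u * v) - KL * (u′ * v′) ≡ (L′ * v) * (K′ * u - K * u′) + (K * u′) * (L′ * v - L * v′)
      cross-multiplied K K′ L L′ u u′ v v′ refl refl = solve (K ∷ K′ ∷ L ∷ L′ ∷ u ∷ u′ ∷ v ∷ v′ ∷ [])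

    ⊖-cong : ∀ {x x′} → x ≋ x′ → ⊖ x ≋ ⊖ x′
    ⊖-cong {u /p^ k} {u′ /p^ k′} (≈⇒≋ u≈u′) = ≈⇒≋ λ n →
      subst (p^ n ∣_) (cross-multiplied (p^ k) (p^ k′) (seq u n) (seq u′ n)) (∣m⇒∣-m (u≈u′ n))
      where
      cross-multiplied : ∀ K K′ u u′ → - (K′ * u - K * u′) ≡ K′ * - u - K * - u′
      cross-multiplied = solve-∀

    ⊕-assoc : ∀ x y z → (x ⊕ y) ⊕ z ≋ x ⊕ (y ⊕ z)
    ⊕-assoc (u /p^ k) (v /p^ l) (w /p^ j) = ≈⇒≋ λ n → i≡j⇒k∣i-j
      (cross-multiplied (p^ k) (p^ l) (p^ j) (seq u n) (seq v n) (seq w n)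
                (p^-+ k l) (p^-+ l j) (p^-+ k (l ℕ.+ j)) (p^-+ (k ℕ.+ l) j))
      where
      cross-multiplied : ∀ K L J u v w {KL LJ K[LJ] [KL]J} →
        KL ≡ K * L → LJ ≡ L * J → K[LJ] ≡ K * LJ → [KL]J ≡ KL * J →
        K[LJ] * (J * (L * u + K * v) + KL * w) ≡ [KL]J * (LJ * u + K * (J * v + L * w))
      cross-multiplied K L J u v w refl refl refl refl = solve (K ∷ L ∷ J ∷ u ∷ v ∷ w ∷ [])

    ⊕-comm : ∀ x y → x ⊕ y ≋ y ⊕ x
    ⊕-comm (u /p^ k) (v /p^ l) = ≈⇒≋ λ n → i≡j⇒k∣i-j
      (cross-multiplied (p^ k) (p^ l) (seq u n) (seq v n) (p^-+ l k) (p^-+ k l))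
      where
      cross-multiplied : ∀ K L u v {LK KL} → LK ≡ L * K → KL ≡ K * L → LK * (L * u + K * v) ≡ KL * (K * v + L * u)
      cross-multiplied K L u v refl refl = solve (K ∷ L ∷ u ∷ v ∷ [])

    ⊕-identityˡ : ∀ x → 0ₚ ⊕ x ≋ x
    ⊕-identityˡ (u /p^ k) = ≈⇒≋ λ n → i≡j⇒k∣i-j (cross-multiplied (p^ k) (seq u n))
      where
      cross-multiplied : ∀ K u → K * (K * + 0 + + 1 * u) ≡ K * u
      cross-multiplied = solve-∀

    ⊖-inverseˡ : ∀ x → (⊖ x) ⊕ x ≋ 0ₚ
    ⊖-inverseˡ (u /p^ k) = ≈⇒≋ λ n → i≡j⇒k∣i-j (cross-multiplied (p^ k) (p^ (k ℕ.+ k)) (seq u n))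
      where
      cross-multiplied : ∀ K KK u → + 1 * (K * - u + K * u) ≡ KK * + 0
      cross-multiplied = solve-∀

    ⊗-assoc : ∀ x y z → (x ⊗ y) ⊗ z ≋ x ⊗ (y ⊗ z)
    ⊗-assoc (u /p^ k) (v /p^ l) (w /p^ j) = ≈⇒≋ λ n → i≡j⇒k∣i-j
      (cross-multiplied (p^ k) (p^ l) (p^ j) (seq u n) (seq v n) (seq w n)
                (p^-+ k l) (p^-+ l j) (p^-+ k (l ℕ.+ j)) (p^-+ (k ℕ.+ l) j))
      where
      cross-multiplied : ∀ K L J u v w {KL LJ K[LJ] [KL]J} →
        KL ≡ K * L → LJ ≡ L * J → K[LJ] ≡ K * LJ → [KL]J ≡ KL * J →
        K[LJ] * ((u * v) * w) ≡ [KL]J * (u * (v * w))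
      cross-multiplied K L J u v w refl refl refl refl = solve (K ∷ L ∷ J ∷ u ∷ v ∷ w ∷ [])

    ⊗-comm : ∀ x y → x ⊗ y ≋ y ⊗ x
    ⊗-comm (u /p^ k) (v /p^ l) = ≈⇒≋ λ n → i≡j⇒k∣i-j
      (cross-multiplied (p^ k) (p^ l) (seq u n) (seq v n) (p^-+ l k) (p^-+ k l))
      where
      cross-multiplied : ∀ K L u v {LK KL} → LK ≡ L * K → KL ≡ K * L → LK * (u * v) ≡ KL * (v * u)
      cross-multiplied K L u v refl refl = solve (K ∷ L ∷ u ∷ v ∷ [])

    ⊗-identityˡ : ∀ x → 1ₚ ⊗ x ≋ x
    ⊗-identityˡ (u /p^ k) = ≈⇒≋ λ n → i≡j⇒k∣i-j (cross-multiplied (p^ k) (seq u n))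
      where
      cross-multiplied : ∀ K u → K * (+ 1 * u) ≡ K * u
      cross-multiplied = solve-∀

    ⊗-distribˡ-⊕ : ∀ x y z → x ⊗ (y ⊕ z) ≋ x ⊗ y ⊕ x ⊗ z
    ⊗-distribˡ-⊕ (u /p^ k) (v /p^ l) (w /p^ j) = ≈⇒≋ λ n → i≡j⇒k∣i-j
      (cross-multiplied (p^ k) (p^ l) (p^ j) (seq u n) (seq v n) (seq w n)
                (p^-+ (k ℕ.+ l) (k ℕ.+ j)) (p^-+ k l) (p^-+ k j) (p^-+ k (l ℕ.+ j)) (p^-+ l j))
      where
      cross-multiplied : ∀ K L J u v w {[KL][KJ] KL KJ K[LJ] LJ} →
        [KL][KJ] ≡ KL * KJ → KL ≡ K * L → KJ ≡ K * J → K[LJ] ≡ K * LJ → LJ ≡ L * J →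
        [KL][KJ] * (u * (J * v + L * w)) ≡ K[LJ] * (KJ * (u * v) + KL * (u * w))
      cross-multiplied K L J u v w refl refl refl refl refl = solve (K ∷ L ∷ J ∷ u ∷ v ∷ w ∷ [])

    /ₚp^-distrib-⊕ : ∀ m x y → (x /ₚp^ m) ⊕ (y /ₚp^ m) ≋ (x ⊕ y) /ₚp^ m
    /ₚp^-distrib-⊕ m (u /p^ k) (v /p^ l) = ≈⇒≋ λ n → i≡j⇒k∣i-j
      (cross-multiplied (p^ k) (p^ l) (p^ m) (seq u n) (seq v n)
                (p^-+ (k ℕ.+ l) m) (p^-+ k l) (p^-+ l m) (p^-+ k m) (p^-+ (k ℕ.+ m) (l ℕ.+ m)))
      where
      cross-multiplied : ∀ K L M u v {[KL]M KL LM KM [KM][LM]} →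
        [KL]M ≡ KL * M → KL ≡ K * L → LM ≡ L * M → KM ≡ K * M → [KM][LM] ≡ KM * LM →
        [KL]M * (LM * u + KM * v) ≡ [KM][LM] * (L * u + K * v)
      cross-multiplied K L M u v refl refl refl refl refl = solve (K ∷ L ∷ M ∷ u ∷ v ∷ [])

    [p^ₚm⊗ιs]/ₚp^m≋ιs : ∀ m s → (p^ₚ m ⊗ ι s) /ₚp^ m ≋ ι s
    [p^ₚm⊗ιs]/ₚp^m≋ιs m s = ≈⇒≋ λ n → i≡j⇒k∣i-j (cross-multiplied (p^ m) (seq s n))
      where
      cross-multiplied : ∀ M s → + 1 * (M * s) ≡ M * s
      cross-multiplied = solve-∀

    ι-+ : ∀ s t → ι (s +ℤₚ t) ≋ ι s ⊕ ι t
    ι-+ s t = ≈⇒≋ λ n → i≡j⇒k∣i-j (cross-multiplied (seq s n) (seq t n))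
      where
      cross-multiplied : ∀ s t → + 1 * (s + t) ≡ + 1 * (+ 1 * s + + 1 * t)
      cross-multiplied = solve-∀

    ι-* : ∀ s t → ι (s *ℤₚ t) ≋ ι s ⊗ ι t
    ι-* s t = ≈⇒≋ λ n → k∣i-i (+ 1 * (seq s n * seq t n))

    ι-neg : ∀ s → ι (-ℤₚ s) ≋ ⊖ ι s
    ι-neg s = ≈⇒≋ λ n → k∣i-i (+ 1 * - seq s n)

    ι-cong : ∀ {s t} → s ≈ℤₚ t → ι s ≋ ι t
    ι-cong {s} {t} s≈t = ≈⇒≋ λ n → subst (p^ n ∣_) (cross-multiplied (seq s n) (seq t n)) (s≈t n)
      where
      cross-multiplied : ∀ s t → s - t ≡ + 1 * s - + 1 * t
      cross-multiplied = solve-∀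

  /ₚp^-cong : ∀ m {x y} → x ≋ y → x /ₚp^ m ≋ y /ₚp^ m
  /ₚp^-cong m {u /p^ k} {v /p^ l} (≈⇒≋ x≈y) = ≈⇒≋ λ n → subst (p^ n ∣_)
    (sym (cross-multiplied (p^ k) (p^ l) (p^ m) (seq u n) (seq v n) (p^-+ l m) (p^-+ k m)))
    (∣n⇒∣m*n (p^ m) (x≈y n))
    where
    cross-multiplied : ∀ K L M u v {LM KM} → LM ≡ L * M → KM ≡ K * M → LM * u - KM * v ≡ M * (L * u - K * v)
    cross-multiplied K L M u v refl refl = solve (K ∷ L ∷ M ∷ u ∷ v ∷ [])

  ι-minus : ∀ s t → ι (s -ℤₚ t) ≋ ι s ⊕ ⊖ ι t
  ι-minus s t = ≋-trans (ι-+ s (-ℤₚ t)) (⊕-cong (≋-refl {ι s}) (ι-neg t))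

  p∣p^m : ∀ {m} → 1 ≤ m → + p ∣ p^ m
  p∣p^m {suc m} _ = divides (p^ m) (trans (pos-* p (p ℕ.^ m)) (ℤ*-comm (+ p) (p^ m)))

  ≋-isEquivalence : IsEquivalence _≋_
  ≋-isEquivalence = record { refl = ≋-refl ; sym = ≋-sym ; trans = ≋-trans }

  ≋-setoid : Setoid 0ℓ 0ℓ
  ≋-setoid = record { isEquivalence = ≋-isEquivalence }

  open Consequences ≋-setoid using (comm∧idˡ⇒id; comm∧invˡ⇒inv; comm∧distrˡ⇒distr)

  ℚₚ-commutativeRing : CommutativeRing 0ℓ 0ℓ
  ℚₚ-commutativeRing = record
    { Carrier = ℚₚ p ; _≈_ = _≋_ ; _+_ = _⊕_ ; _*_ = _⊗_ ; -_ = ⊖_ ; 0# = 0ₚ ; 1# = 1ₚ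
    ; isCommutativeRing = record
      { isRing = record
        { +-isAbelianGroup = record
          { isGroup = record
            { isMonoid = record
              { isSemigroup = record
                { isMagma = record { isEquivalence = ≋-isEquivalence ; ∙-cong = ⊕-cong }
                ; assoc = ⊕-assoc }
              ; identity = comm∧idˡ⇒id ⊕-comm ⊕-identityˡ }
            ; inverse = comm∧invˡ⇒inv ⊕-comm ⊖-inverseˡ
            ; ⁻¹-cong = ⊖-cong }
          ; comm = ⊕-comm }
        ; *-cong = ⊗-cong
        ; *-assoc = ⊗-assoc
        ; *-identity = comm∧idˡ⇒id ⊗-comm ⊗-identityˡ
        ; distrib = comm∧distrˡ⇒distr ⊕-cong ⊗-comm ⊗-distribˡ-⊕ }
      ; *-comm = ⊗-comm } }

  opaque
    unfolding _⊕_ _⊗_ ⊖_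

    ℤ⟶ℚₚ : +-*-rawRing -Raw-AlmostCommutative⟶ fromCommutativeRing ℚₚ-commutativeRing
    ℤ⟶ℚₚ = record
      { ⟦_⟧    = λ i → ι (constℤₚ i)
      ; +-homo = λ i j → ≈⇒≋ λ n → i≡j⇒k∣i-j (cross-multiplied i j)
      ; *-homo = λ i j → ≈⇒≋ λ n → k∣i-i (+ 1 * (i * j))
      ; -‿homo = λ i → ≈⇒≋ λ n → k∣i-i (+ 1 * - i)
      ; 0-homo = ≋-refl
      ; 1-homo = ≋-refl }
      where
      cross-multiplied : ∀ i j → + 1 * (i + j) ≡ + 1 * (+ 1 * i + + 1 * j)
      cross-multiplied = solve-∀

  open RingIdentities ℚₚ-commutativeRing ℤ⟶ℚₚ public

  geometric : ℤ → ℕ → ℤ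
  geometric r zero    = + 0
  geometric r (suc n) = + 1 + r * geometric r n

  [1-r]*geometric : ∀ r n → (+ 1 - r) * geometric r n ≡ + 1 - r ^ n
  [1-r]*geometric r zero    = base r
    where
    base : ∀ r → (+ 1 - r) * + 0 ≡ + 1 - + 1
    base = solve-∀
  [1-r]*geometric r (suc n) = begin
    (+ 1 - r) * (+ 1 + r * geometric r n)     ≡⟨ expand r (geometric r n) ⟩
    + 1 - r + r * ((+ 1 - r) * geometric r n) ≡⟨ cong (λ g → + 1 - r + r * g) ([1-r]*geometric r n) ⟩
    + 1 - r + r * (+ 1 - r ^ n)               ≡⟨ collect r (r ^ n) ⟩
    + 1 - r * r ^ n                           ∎
    where
    expand : ∀ r g → (+ 1 - r) * (+ 1 + r * g) ≡ + 1 - r + r * ((+ 1 - r) * g)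
    expand = solve-∀
    open ≡-Reasoning
    collect : ∀ r w → + 1 - r + r * (+ 1 - w) ≡ + 1 - r * w
    collect = solve-∀

  geometric-suc : ∀ r n → geometric r (suc n) ≡ geometric r n + r ^ n
  geometric-suc r zero    = base r
    where
    base : ∀ r → + 1 + r * + 0 ≡ + 0 + + 1
    base = solve-∀
  geometric-suc r (suc n) = begin
    + 1 + r * geometric r (suc n)          ≡⟨ cong (λ g → + 1 + r * g) (geometric-suc r n) ⟩
    + 1 + r * (geometric r n + r ^ n)      ≡⟨ distribute r (geometric r n) (r ^ n) ⟩
    (+ 1 + r * geometric r n) + r * r ^ n  ∎
    where
    open ≡-Reasoning
    distribute : ∀ r g w → + 1 + r * (g + w) ≡ (+ 1 + r * g) + r * w
    distribute = solve-∀

  r-s∣geometric-r-geometric-s : ∀ r s n → r - s ∣ geometric r n - geometric s n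
  r-s∣geometric-r-geometric-s r s zero    = k∣i-i (+ 0)
  r-s∣geometric-r-geometric-s r s (suc n) = subst (r - s ∣_) (sym (split r s (geometric r n) (geometric s n)))
    (∣m∣n⇒∣m+n (∣n⇒∣m*n r (r-s∣geometric-r-geometric-s r s n)) (∣m⇒∣m*n (geometric s n) ∣-refl))
    where
    split : ∀ r s g h → (+ 1 + r * g) - (+ 1 + s * h) ≡ r * (g - h) + (r - s) * h
    split = solve-∀

  p∣r⇒p^n∣r^n : ∀ {r} → + p ∣ r → ∀ n → p^ n ∣ r ^ n
  p∣r⇒p^n∣r^n p∣r zero    = ∣-refl
  p∣r⇒p^n∣r^n {r} p∣r (suc n) = subst (_∣ r * r ^ n) (sym (pos-* p (p ℕ.^ n)))
    (∣-trans (*-monoˡ-∣ (p^ n) p∣r) (*-monoʳ-∣ r (p∣r⇒p^n∣r^n p∣r n)))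

  -- At level n the inverse of 1 + q is the truncated geometric series
  -- Σ_{i<n} (-qₙ)ⁱ, whose error term qₙⁿ is divisible by pⁿ.
  p∣q⇒1+q-invertible : (q : ℤₚ p) → (∀ n → + p ∣ seq q n) →
    Σ (ℤₚ p) λ ν → (1ℤₚ +ℤₚ q) *ℤₚ ν ≈ℤₚ 1ℤₚ
  p∣q⇒1+q-invertible q p∣q = mkℤₚ ν ν-coh , inverse
    where
    r : ℕ → ℤ
    r n = - seq q n
    p∣r : ∀ n → + p ∣ r n
    p∣r n = ∣m⇒∣-m (p∣q n)
    ν : ℕ → ℤ
    ν n = geometric (r n) n
    ν-coh : ∀ n → p^ n ∣ ν (suc n) - ν n
    ν-coh n = subst (p^ n ∣_) (sym split)
      (∣m∣n⇒∣m+n (∣-trans r-coh (r-s∣geometric-r-geometric-s (r (suc n)) (r n) n))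
                 (p∣r⇒p^n∣r^n (p∣r (suc n)) n))
      where
      negate : ∀ a b → - (a - b) ≡ - a - - b
      negate = solve-∀
      r-coh : p^ n ∣ r (suc n) - r n
      r-coh = subst (p^ n ∣_) (negate (seq q (suc n)) (seq q n)) (∣m⇒∣-m (coh q n))
      rearrange : ∀ g w h → g + w - h ≡ (g - h) + w
      rearrange = solve-∀
      split : ν (suc n) - ν n ≡ (geometric (r (suc n)) n - ν n) + r (suc n) ^ n
      split = trans (cong (_- ν n) (geometric-suc (r (suc n)) n))
                    (rearrange (geometric (r (suc n)) n) (r (suc n) ^ n) (ν n))
    inverse : ∀ n → p^ n ∣ (+ 1 + seq q n) * ν n - + 1
    inverse n = subst (p^ n ∣_) (sym error-term) (∣m⇒∣-m (p∣r⇒p^n∣r^n (p∣r n) n))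
      where
      1+q≡1-r : ∀ q → + 1 + q ≡ + 1 - - q
      1+q≡1-r = solve-∀
      open ≡-Reasoning
      cancel : ∀ w → + 1 - w - + 1 ≡ - w
      cancel = solve-∀
      error-term : (+ 1 + seq q n) * ν n - + 1 ≡ - (r n ^ n)
      error-term = begin
        (+ 1 + seq q n) * ν n - + 1 ≡⟨ cong (λ a → a * ν n - + 1) (1+q≡1-r (seq q n)) ⟩
        (+ 1 - r n) * ν n - + 1     ≡⟨ cong (_- + 1) ([1-r]*geometric (r n) n) ⟩
        + 1 - r n ^ n - + 1         ≡⟨ cancel (r n ^ n) ⟩
        - (r n ^ n)                 ∎

  1+p^m*s-invertible : ∀ {m} → 1 ≤ m → ∀ s →
    Σ (ℤₚ p) λ ν → (1ℤₚ +ℤₚ constℤₚ (p^ m) *ℤₚ s) *ℤₚ ν ≈ℤₚ 1ℤₚ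
  1+p^m*s-invertible {m} 1≤m s =
    p∣q⇒1+q-invertible (constℤₚ (p^ m) *ℤₚ s) λ n → ∣m⇒∣m*n (seq s n) (p∣p^m 1≤m)

module Convexity {p : ℕ} .{{p-nontrivial : ℕ.NonTrivial p}} where

  open Defs using (_≈_)
  open PAdic {p}
  open CommutativeRing ℚₚ-commutativeRing public using (_+_; _*_; -_; _-_; 1#)
  open CommutativeRing ℚₚ-commutativeRing
    using (+-cong; +-congˡ; +-congʳ; *-congˡ; *-congʳ; +-assoc; *-assoc; distribʳ; zeroˡ; ring; setoid)
  open import Algebra.Properties.Ring ring using (-1*x≈-x)
  open import Relation.Binary.Reasoning.Setoid setoid

  Translate : Pred (ℚₚ p) 0ℓ → ℚₚ p → Pred (ℚₚ p) 0ℓ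
  Translate L u x = Σ (ℚₚ p) λ l → L l × x ≋ l + u

  Span : ℚₚ p → Pred (ℚₚ p) 0ℓ
  Span w l = Σ (ℤₚ p) λ t → l ≋ ι t * w

  module Submodule {L : Pred (ℚₚ p) 0ℓ} (L-sub : IsSubmodule L) where

    resp : ∀ {x y} → x ≋ y → L x → L y
    resp {x} {y} (≈⇒≋ x≈y) = IsSubmodule.resp L-sub {x} {y} x≈y

    opaque
      unfolding _⊕_ _⊗_ ⊖_

      +-closed : ∀ {x y} → L x → L y → L (x + y)
      +-closed {x} {y} = IsSubmodule.+-closed L-sub {x} {y}

      scale-closed : ∀ r {x} → L x → L (ι r * x)
      scale-closed r {x} = IsSubmodule.scale-closed L-sub r {x}

    neg-closed : ∀ {x} → L x → L (- x)
    neg-closed {x} x∈L =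
      resp (≋-trans (*-congʳ {x} (ι-neg 1ℤₚ)) (-1*x≈-x x)) (scale-closed (-ℤₚ 1ℤₚ) x∈L)

  span-+-closed : ∀ {w x y} → Span w x → Span w y → Span w (x + y)
  span-+-closed {w} {x} {y} (t , x≋tw) (s , y≋sw) = t +ℤₚ s , (begin
    x + y                  ≈⟨ +-cong x≋tw y≋sw ⟩
    ι t * w + ι s * w      ≈⟨ distribʳ w (ι t) (ι s) ⟨
    (ι t + ι s) * w        ≈⟨ *-congʳ (ι-+ t s) ⟨
    ι (t +ℤₚ s) * w        ∎)

  span-scale-closed : ∀ {w} r {x} → Span w x → Span w (ι r * x)
  span-scale-closed {w} r {x} (t , x≋tw) = r *ℤₚ t , (begin
    ι r * x                ≈⟨ *-congˡ x≋tw ⟩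
    ι r * (ι t * w)        ≈⟨ *-assoc (ι r) (ι t) w ⟨
    (ι r * ι t) * w        ≈⟨ *-congʳ (ι-* r t) ⟨
    ι (r *ℤₚ t) * w        ∎)

  opaque
    unfolding _⊕_ _⊗_ ⊖_

    span-isSubmodule : ∀ w → IsSubmodule (Span w)
    span-isSubmodule w = record
      { resp         = λ {x} {y} x≈y (t , x≋tw) → t , ≋-trans (≋-sym (≈⇒≋ {x} {y} x≈y)) x≋tw
      ; zero∈        = constℤₚ (+ 0) , ≋-sym (zeroˡ w)
      ; +-closed     = λ {x} {y} → span-+-closed {w} {x} {y}
      ; scale-closed = λ r {x} → span-scale-closed {w} r {x}
      }

    translate-isConvex : ∀ {L u} → IsSubmodule L → Convex (Translate L u)
    translate-isConvex {L} {u} L-sub = inj₂ (L , L-sub , u , λ x →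
      mk⇔ (λ (l , l∈L , x≋l+u) → l , l∈L , ≋⇒≈ {x} {l + u} x≋l+u)
          (λ (l , l∈L , x≈l+u) → l , l∈L , ≈⇒≋ x≈l+u))

    convex⇔translate : ∀ {C L : Pred (ℚₚ p) 0ℓ} {u} →
      (∀ x → C x ⇔ (Σ (ℚₚ p) λ l → L l × x ≈ l +ₚ u)) → ∀ x → C x ⇔ Translate L u x
    convex⇔translate {u = u} C⇔L+u x = mk⇔
      (λ x∈C → let (l , l∈L , x≈l+u) = Equivalence.to (C⇔L+u x) x∈C in l , l∈L , ≈⇒≋ x≈l+u)
      (λ (l , l∈L , x≋l+u) → Equivalence.from (C⇔L+u x) (l , l∈L , ≋⇒≈ {x} {l + u} x≋l+u))

  span⊆ : ∀ {L w} → IsSubmodule L → L w → Span w ⊆ L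
  span⊆ L-sub w∈L (t , l≋tw) = Submodule.resp L-sub (≋-sym l≋tw) (Submodule.scale-closed L-sub t w∈L)

  translate-⊆ : ∀ {L L′ u y} → IsSubmodule L → L′ ⊆ L → Translate L u y → Translate L′ y ⊆ Translate L u
  translate-⊆ {u = u} {y} L-sub L′⊆L (l , l∈L , y≋l+u) {x} (l′ , l′∈L′ , x≋l′+y) =
    l′ + l , Submodule.+-closed L-sub (L′⊆L l′∈L′) l∈L , (begin
      x             ≈⟨ x≋l′+y ⟩
      l′ + y        ≈⟨ +-congˡ y≋l+u ⟩
      l′ + (l + u)  ≈⟨ +-assoc l′ l u ⟨
      (l′ + l) + u  ∎)

  translate-difference∈ : ∀ {L u x y} → IsSubmodule L → Translate L u x → Translate L u y → L (x - y)
  translate-difference∈ L-sub (l , l∈L , x≋l+u) (l′ , l′∈L , y≋l′+u) =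
    Submodule.resp L-sub (≋-sym ([l+u]-[l′+u]≈l-l′ x≋l+u y≋l′+u))
      (Submodule.+-closed L-sub l∈L (Submodule.neg-closed L-sub l′∈L))

  translate-span-onto : ∀ {w x₀} z (h : ℚₚ p → ℚₚ p) →
    (∀ t {x} → x ≋ ι t * w + x₀ → h x ≋ ι (t +ℤₚ z)) → MapsOntoℤₚ (Translate (Span w) x₀) h
  translate-span-onto {w} {x₀} z h h-on-line = into , onto
    where
    into : ∀ x → Translate (Span w) x₀ x → Inℤₚ (h x)
    into x (l , (t , l≋tw) , x≋l+x₀) =
      t +ℤₚ z , ≋⇒≈ {h x} (h-on-line t (≋-trans x≋l+x₀ (+-congʳ l≋tw)))
    onto : ∀ y → Σ (ℚₚ p) λ x → Translate (Span w) x₀ x × h x ≈ ι y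
    onto y = ι t * w + x₀ , (ι t * w , (t , ≋-refl) , ≋-refl) ,
             ≋⇒≈ {h (ι t * w + x₀)}
               (≋-trans (h-on-line t ≋-refl) (ι-cong {t +ℤₚ z} {y} ([s-t]+t≈s y z)))
      where
      t = y -ℤₚ z

  opaque
    unfolding _⊕_ _⊗_ ⊖_

    coset⇒≋ : ∀ {d m x} → Coset d m x → Σ (ℤₚ p) λ z → x ≋ ι d + p^ₚ m * ι z
    coset⇒≋ (z , x≈) = z , ≈⇒≋ x≈

    onto⇒≋ : ∀ {S : Pred (ℚₚ p) 0ℓ} {a c} → MapsOntoℤₚ S (λ x → a *ₚ x +ₚ c) →
      ∀ y → Σ (ℚₚ p) λ x → S x × a * x + c ≋ ι y
    onto⇒≋ (_ , onto) y = let (x , x∈S , fx≈y) = onto y in x , x∈S , ≈⇒≋ fx≈y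

  ∃[r]a*w+w≋p^ₚm : ∀ {m} → 1 ≤ m → ∀ {a c d x₀ x₁ z₀ z₁ y} →
    x₀ ≋ ι d + p^ₚ m * ι z₀ → x₁ ≋ ι d + p^ₚ m * ι z₁ →
    a * x₀ + c ≋ ι y → a * x₁ + c ≋ ι (y +ℤₚ 1ℤₚ) →
    Σ (ℤₚ p) λ r → a * (ι r * (x₁ - x₀)) + ι r * (x₁ - x₀) ≋ p^ₚ m
  ∃[r]a*w+w≋p^ₚm {m} 1≤m {a} {c} {d} {x₀} {x₁} {z₀} {z₁} {y} x₀≋ x₁≋ fx₀≋ fx₁≋ =
    constℤₚ (p^ m) *ℤₚ ν , a*w+w≈P (*-congʳ (ι-* (constℤₚ (p^ m)) ν)) aδ≋1 [1+δ]ν≋1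
    where
    q : ℤₚ p
    q = constℤₚ (p^ m) *ℤₚ (z₁ -ℤₚ z₀)
    δ≋q : x₁ - x₀ ≋ ι q
    δ≋q = begin
      x₁ - x₀                   ≈⟨ [d+Pz]-[d+Pz′]≈P[z-z′] x₁≋ x₀≋ ⟩
      p^ₚ m * (ι z₁ - ι z₀)     ≈⟨ *-congˡ (ι-minus z₁ z₀) ⟨
      p^ₚ m * ι (z₁ -ℤₚ z₀)     ≈⟨ ι-* (constℤₚ (p^ m)) (z₁ -ℤₚ z₀) ⟨
      ι q                       ∎
    aδ≋1 : a * (x₁ - x₀) ≋ 1#
    aδ≋1 = a[x-y]≈1 (≋-trans fx₁≋ (ι-+ y 1ℤₚ)) fx₀≋
    ν : ℤₚ p
    ν = proj₁ (1+p^m*s-invertible 1≤m (z₁ -ℤₚ z₀))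
    [1+q]ν≈1 : (1ℤₚ +ℤₚ q) *ℤₚ ν ≈ℤₚ 1ℤₚ
    [1+q]ν≈1 = proj₂ (1+p^m*s-invertible 1≤m (z₁ -ℤₚ z₀))
    [1+δ]ν≋1 : (1# + (x₁ - x₀)) * ι ν ≋ 1#
    [1+δ]ν≋1 = begin
      (1# + (x₁ - x₀)) * ι ν   ≈⟨ *-congʳ (+-congˡ δ≋q) ⟩
      (1# + ι q) * ι ν         ≈⟨ *-congʳ (ι-+ 1ℤₚ q) ⟨
      ι (1ℤₚ +ℤₚ q) * ι ν      ≈⟨ ι-* (1ℤₚ +ℤₚ q) ν ⟨
      ι ((1ℤₚ +ℤₚ q) *ℤₚ ν)    ≈⟨ ι-cong {(1ℤₚ +ℤₚ q) *ℤₚ ν} {1ℤₚ} [1+q]ν≈1 ⟩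
      1#                       ∎

  rescaled : ℕ → ℚₚ p → ℚₚ p → ℤₚ p → ℚₚ p → ℚₚ p
  rescaled m a c β x = ((a *ₚ x +ₚ c) /ₚp^ m) +ₚ ((x -ₚ ι β) /ₚp^ m)

  opaque
    unfolding _⊕_ _⊗_ ⊖_

    -- Going through _≈_ compares only the integer sequences; comparing the two sides
    -- as elements of ℚₚ p would normalise their coherence proofs.
    rescaled≋ : ∀ m a c β x → rescaled m a c β x ≋ ((a * x + c) /ₚp^ m) + ((x - ι β) /ₚp^ m)
    rescaled≋ m a c β x = ≈⇒≋ (≋⇒≈ (≋-refl {rescaled m a c β x}))

  rescaled-on-line : ∀ m a c β {d w x₀} z₀ →
    x₀ ≋ ι d + p^ₚ m * ι z₀ → a * w + w ≋ p^ₚ m → a * x₀ + c ≋ ι (β -ℤₚ d) →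
    ∀ t {x} → x ≋ ι t * w + x₀ → rescaled m a c β x ≋ ι (t +ℤₚ z₀)
  rescaled-on-line m a c β {d} {w} {x₀} z₀ x₀≋ aw+w≋p^m fx₀≋ t {x} x≋ = begin
    rescaled m a c β x
      ≈⟨ rescaled≋ m a c β x ⟩
    ((a * x + c) /ₚp^ m) + ((x - ι β) /ₚp^ m)
      ≈⟨ /ₚp^-distrib-⊕ m (a * x + c) (x - ι β) ⟩
    ((a * x + c) + (x - ι β)) /ₚp^ m
      ≈⟨ /ₚp^-cong m ([ax+c]+[x-b]≈P[t+z] aw+w≋p^m (≋-trans fx₀≋ (ι-minus β d)) x₀≋ x≋) ⟩
    (p^ₚ m * (ι t + ι z₀)) /ₚp^ m
      ≈⟨ /ₚp^-cong m (*-congˡ (ι-+ t z₀)) ⟨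
    (p^ₚ m * ι (t +ℤₚ z₀)) /ₚp^ m
      ≈⟨ [p^ₚm⊗ιs]/ₚp^m≋ιs m (t +ℤₚ z₀) ⟩
    ι (t +ℤₚ z₀)
      ∎

open PAdic
open Convexity

lemma3p14 : (p : ℕ) → Prime p → (m : ℕ) → 1 ≤ m → (d : ℤₚ p)
    → (C : Pred (ℚₚ p) 0ℓ) → Convex C → C ⊆ Coset d m
    → (a c : ℚₚ p) → MapsOntoℤₚ C (λ x → a *ₚ x +ₚ c)
    → (β : ℤₚ p)
    → Σ (Pred (ℚₚ p) 0ℓ) λ B → Convex B × B ⊆ C
        × MapsOntoℤₚ B (λ x → ((a *ₚ x +ₚ c) /ₚp^ m) +ₚ ((x -ₚ ι β) /ₚp^ m))
lemma3p14 p (prime _) m 1≤m d C (inj₁ C-empty) C⊆D a c (_ , f-onto) β =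
  ⊥-elim (C-empty _ (proj₁ (proj₂ (f-onto (constℤₚ (+ 0))))))
-- Arguments occurring only under the computing operations of Defs cannot be
-- inferred by unification, hence the explicitly supplied implicit arguments.
lemma3p14 p (prime _) m 1≤m d C (inj₂ (L , L-sub , u , C⇔L+u)) C⊆D a c f-onto β =
  let (x₀ , x₀∈C , fx₀≋) = onto⇒≋ {S = C} {a = a} {c = c} f-onto (β -ℤₚ d)
      (x₁ , x₁∈C , fx₁≋) = onto⇒≋ {S = C} {a = a} {c = c} f-onto (β -ℤₚ d +ℤₚ 1ℤₚ)
      (z₀ , x₀≋) = coset⇒≋ {d = d} {m = m} (C⊆D x₀∈C)
      (z₁ , x₁≋) = coset⇒≋ {d = d} {m = m} (C⊆D x₁∈C)
      (r , aw+w≋p^m) = ∃[r]a*w+w≋p^ₚm 1≤m x₀≋ x₁≋ fx₀≋ fx₁≋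
      w = ι r * (x₁ - x₀)
      C⇔ = convex⇔translate {C = C} {L = L} {u = u} C⇔L+u
      w∈L = Submodule.scale-closed L-sub r
              (translate-difference∈ L-sub (Equivalence.to (C⇔ x₁) x₁∈C) (Equivalence.to (C⇔ x₀) x₀∈C))
  in Translate (Span w) x₀ , translate-isConvex (span-isSubmodule w) ,
     (λ {x} x∈B → Equivalence.from (C⇔ x)
       (translate-⊆ L-sub (span⊆ L-sub w∈L) (Equivalence.to (C⇔ x₀) x₀∈C) x∈B)) ,
     translate-span-onto z₀ (rescaled m a c β) (rescaled-on-line m a c β z₀ x₀≋ aw+w≋p^m fx₀≋)
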